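{- Let $n \geq 2$ be an integer, let $P_n$ be the path with $n$ vertices, and let $B_n$ be the barbell graph consisting of two disjoint cliques of sizes $\lceil n/2\rceil$ and $\lfloor n/2\rfloor$ connected by a single edge (joining one vertex of the first clique to one vertex of the second). Then $\mathcal{AC}(P_n) = \mathcal{AC}(B_n) = n-2$.
   Context: Acquaintance time: let $G=(V,E)$ be a finite connected graph. Initially one agent is placed on each vertex. At any moment, two agents located at the endpoints of a common edge become acquainted (this applies to the initial placement and to the placement after every round). In each round one chooses a matching of $G$ (not necessarily maximal), and for each edge of the matching the two agents on its endpoints swap places. A sequence of matchings after which every pair of agents has been acquainted at some moment is a strategy for acquaintance in $G$. The acquaintance time $\mathcal{AC}(G)$ is the minimal number of rounds (matchings) in a strategy for acquaintance in $G$. -}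

module Defs where

open import Data.Nat using (ℕ; zero; suc; _+_; _≤_; _<_; ⌈_/2⌉)
open import Data.Fin using (Fin; toℕ)
open import Data.List using (List; length; take; foldl)
open import Data.Product using (Σ; ∃; ∃-syntax; _×_; _,_)
open import Data.Sum using (_⊎_)
open import Relation.Binary.PropositionalEquality using (_≡_; _≢_)
open import Relation.Nullary using (¬_)
open import Function using (_∘_; id)

record Graph (n : ℕ) : Set₁ where
  field
    Adj     : Fin n → Fin n → Set
    adjSym  : ∀ {u v} → Adj u v → Adj v u
    adjIrr  : ∀ {u} → ¬ Adj u u

open Graph public

-- A matching of G, encoded as an involution m of the vertex set such that every
-- vertex is either fixed (unmatched) or adjacent to its partner m v.
record Matching {n : ℕ} (G : Graph n) : Set where
  field
    partner    : Fin n → Fin n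
    involutive : ∀ v → partner (partner v) ≡ v
    onEdges    : ∀ v → partner v ≡ v ⊎ Adj G v (partner v)

open Matching public

-- A placement: σ v is the agent standing on vertex v.  Agents are named by their
-- initial vertex, so the initial placement is id.  After swapping along a matching
-- m, the agent on v is the one that stood on m v.
step : ∀ {n} {G : Graph n} → (Fin n → Fin n) → Matching G → (Fin n → Fin n)
step σ m = σ ∘ partner m

placement : ∀ {n} {G : Graph n} → List (Matching G) → ℕ → (Fin n → Fin n)
placement ms k = foldl step id (take k ms)

AcquaintedAt : ∀ {n} (G : Graph n) → (Fin n → Fin n) → Fin n → Fin n → Set
AcquaintedAt G σ a b = ∃[ u ] ∃[ v ] (Adj G u v × σ u ≡ a × σ v ≡ b)

IsStrategy : ∀ {n} (G : Graph n) → List (Matching G) → Set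
IsStrategy G ms =
  ∀ a b → a ≢ b → ∃[ k ] (k ≤ length ms × AcquaintedAt G (placement ms k) a b)

IsAcquaintanceTime : ∀ {n} (G : Graph n) → ℕ → Set
IsAcquaintanceTime G t =
  (∃[ ms ] (length ms ≡ t × IsStrategy G ms)) ×
  (∀ ms → IsStrategy G ms → t ≤ length ms)

PathAdj : ∀ {n} → Fin n → Fin n → Set
PathAdj i j = suc (toℕ i) ≡ toℕ j ⊎ suc (toℕ j) ≡ toℕ i

InFirst : ∀ {n} → Fin n → Set
InFirst {n} i = toℕ i < ⌈ n /2⌉

InSecond : ∀ {n} → Fin n → Set
InSecond {n} i = ⌈ n /2⌉ ≤ toℕ i

BarbellAdj : ∀ {n} → Fin n → Fin n → Set
BarbellAdj {n} i j =
  (i ≢ j × ((InFirst i × InFirst j) ⊎ (InSecond i × InSecond j)))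
  ⊎ (suc (toℕ i) ≡ ⌈ n /2⌉ × toℕ j ≡ ⌈ n /2⌉)
  ⊎ (suc (toℕ j) ≡ ⌈ n /2⌉ × toℕ i ≡ ⌈ n /2⌉)

private
  open import Data.Sum using (inj₁; inj₂)
  open import Data.Product using (proj₁; proj₂)
  open import Data.Nat.Properties using (1+n≢n)
  open import Relation.Binary.PropositionalEquality using (refl; sym; trans)
  import Relation.Binary.PropositionalEquality as Eq

  pathSym : ∀ {n} {i j : Fin n} → PathAdj i j → PathAdj j i
  pathSym (inj₁ p) = inj₂ p
  pathSym (inj₂ p) = inj₁ p

  pathIrrefl : ∀ {n} {i : Fin n} → ¬ PathAdj i i
  pathIrrefl (inj₁ p) = 1+n≢n p
  pathIrrefl (inj₂ p) = 1+n≢n p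

  swap× : ∀ {A B : Set} → A × B → B × A
  swap× (a , b) = b , a

  barSym : ∀ {n} {i j : Fin n} → BarbellAdj i j → BarbellAdj j i
  barSym (inj₁ (ne , inj₁ p)) = inj₁ ((λ e → ne (sym e)) , inj₁ (swap× p))
  barSym (inj₁ (ne , inj₂ p)) = inj₁ ((λ e → ne (sym e)) , inj₂ (swap× p))
  barSym (inj₂ (inj₁ p)) = inj₂ (inj₂ p)
  barSym (inj₂ (inj₂ p)) = inj₂ (inj₁ p)

  barIrrefl : ∀ {n} {i : Fin n} → ¬ BarbellAdj i i
  barIrrefl (inj₁ (ne , _)) = ne refl
  barIrrefl (inj₂ (inj₁ (p , q))) = 1+n≢n (trans p (sym q))
  barIrrefl (inj₂ (inj₂ (p , q))) = 1+n≢n (trans p (sym q))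

pathGraph : (n : ℕ) → Graph n
pathGraph n = record { Adj = PathAdj ; adjSym = pathSym ; adjIrr = pathIrrefl }

barbellGraph : (n : ℕ) → Graph n
barbellGraph n = record { Adj = BarbellAdj ; adjSym = barSym ; adjIrr = barIrrefl }

module Submission where

open import Defs
open import Data.Bool using (Bool; true; false; not; _xor_; if_then_else_)
open import Data.Bool.Properties
  using (not-involutive; not-injective; ¬-not; not-distribˡ-xor; xor-same; xor-identityʳ)
  renaming (_≟_ to _≟ᵇ_)
open import Data.Empty using (⊥; ⊥-elim)
open import Data.Fin as Fin using (Fin; toℕ; fromℕ<; inject≤; cast; _↑ʳ_; splitAt; join)
open import Data.Fin.Properties
  using (toℕ-injective; toℕ-fromℕ<; toℕ<n; toℕ-inject≤; inject≤-injective; toℕ-cast; toℕ-↑ʳ;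
         injective⇒≤; join-splitAt)
  renaming (_≟_ to _≟ᶠ_)
open import Data.List using (List; []; _∷_; length; take; foldl; foldr; map)
open import Data.List.Properties using (length-map; take-map)
open import Data.Nat
  using (ℕ; zero; suc; pred; _+_; _∸_; _≤_; _<_; z≤n; s≤s; z<s; ⌊_/2⌋; ⌈_/2⌉; _≟_; _<?_; _≤?_)
open import Data.Nat.Properties
open import Data.Nat.Tactic.RingSolver using (solve-∀)
open import Data.Product using (Σ; ∃; ∃-syntax; _×_; _,_; proj₁; proj₂; swap)
open import Data.Sum using (_⊎_; inj₁; inj₂; map₂)
open import Function using (_∘_; id)
open import Function.Definitions using (Injective)
open import Relation.Binary.Definitions using (tri<; tri≈; tri>)
open import Relation.Binary.PropositionalEquality
open import Relation.Nullary using (¬_; yes; no; ¬?)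
open import Relation.Nullary.Decidable using (decidable-stable)
open import Relation.Unary using (Decidable)

-- In B_n the two cliques are joined by the single edge {ℓ, r}: an agent changes
-- sides, and two agents from different sides get acquainted, only across that edge.  If some
-- agent never leaves the left clique and some agent never leaves the right one, every agent can
-- be labelled by a moment in {0, …, T + 1} at which it stands at that edge, and distinct agents
-- get distinct labels.  If instead every agent of one side leaves it, the first exits take place
-- at distinct moments t, and no first exit happens at t + 1, when ℓ holds an agent that has just
-- come from the other side; as each side has at least ⌊n/2⌋ agents, 2 ⌊n/2⌋ ≤ T + 1.  Either way
-- n ≤ T + 2.  P_n is a spanning subgraph of B_n, so the bound holds for P_n as well.
--
-- In round t swap all pairs {v, v + 1} with v ≡ t (mod 2).  Every agent then walks
-- back and forth along the path at unit speed, even agents starting to the right and odd agents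
-- to the left.  After n − 2 rounds the order of the agents is reversed, up to a defect controlled
-- by parity: two agents either end up adjacent or have swapped their order, and agents on a path
-- cannot swap their order without having been adjacent.

-- Trajectories of agents

module _ {n : ℕ} {G : Graph n} where

  agentOn : List (Matching G) → Fin n → Fin n
  agentOn ms v = foldr partner v ms

  vertexOf : List (Matching G) → Fin n → Fin n
  vertexOf []       a = a
  vertexOf (m ∷ ms) a = vertexOf ms (partner m a)

  position : List (Matching G) → ℕ → Fin n → Fin n
  position ms t = vertexOf (take t ms)

  foldl-step : ∀ σ ms v → foldl step σ ms v ≡ σ (agentOn ms v)
  foldl-step σ []       v = refl
  foldl-step σ (m ∷ ms) v = foldl-step (step σ m) ms v

  vertexOf-agentOn : ∀ ms v → vertexOf ms (agentOn ms v) ≡ v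
  vertexOf-agentOn []       v = refl
  vertexOf-agentOn (m ∷ ms) v =
    trans (cong (vertexOf ms) (involutive m (agentOn ms v))) (vertexOf-agentOn ms v)

  agentOn-vertexOf : ∀ ms a → agentOn ms (vertexOf ms a) ≡ a
  agentOn-vertexOf []       a = refl
  agentOn-vertexOf (m ∷ ms) a =
    trans (cong (partner m) (agentOn-vertexOf ms (partner m a))) (involutive m a)

  placement-position : ∀ ms t a → placement ms t (position ms t a) ≡ a
  placement-position ms t a =
    trans (foldl-step id (take t ms) _) (agentOn-vertexOf (take t ms) a)

  position-placement : ∀ ms t {v a} → placement ms t v ≡ a → position ms t a ≡ v
  position-placement ms t {v} refl =
    trans (cong (vertexOf (take t ms)) (foldl-step id (take t ms) v)) (vertexOf-agentOn (take t ms) v)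

  position-injective : ∀ ms t {a b} → position ms t a ≡ position ms t b → a ≡ b
  position-injective ms t {a} {b} eq = begin
    a                                 ≡⟨ placement-position ms t a ⟨
    placement ms t (position ms t a)  ≡⟨ cong (placement ms t) eq ⟩
    placement ms t (position ms t b)  ≡⟨ placement-position ms t b ⟩
    b                                 ∎
    where open ≡-Reasoning

  position-suc : ∀ ms t → suc t ≤ length ms →
                 Σ (Matching G) λ m → ∀ a → position ms (suc t) a ≡ partner m (position ms t a)
  position-suc (m ∷ ms) zero    _         = m , λ a → refl
  position-suc (m ∷ ms) (suc t) (s≤s t<l) with position-suc ms t t<l
  ... | m′ , moves = m′ , λ a → moves (partner m a)

  position-step : ∀ ms t a → suc t ≤ length ms →
                  position ms (suc t) a ≡ position ms t a ⊎ Adj G (position ms t a) (position ms (suc t) a)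
  position-step ms t a t<l with position-suc ms t t<l
  ... | m , moves rewrite moves a = onEdges m (position ms t a)

  position-swap : ∀ ms t {a b} → suc t ≤ length ms →
                  position ms (suc t) a ≡ position ms t b → position ms t a ≡ position ms (suc t) b
  position-swap ms t {a} {b} t<l eq with position-suc ms t t<l
  ... | m , moves = begin
    position ms t a                       ≡⟨ involutive m (position ms t a) ⟨
    partner m (partner m (position ms t a)) ≡⟨ cong (partner m) (moves a) ⟨
    partner m (position ms (suc t) a)     ≡⟨ cong (partner m) eq ⟩
    partner m (position ms t b)           ≡⟨ moves b ⟨
    position ms (suc t) b                 ∎
    where open ≡-Reasoning

  Meet : List (Matching G) → Fin n → Fin n → Set
  Meet ms a b = ∃[ t ] (t ≤ length ms × Adj G (position ms t a) (position ms t b))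

  strategy⇒meet : ∀ {ms} → IsStrategy G ms → ∀ {a b} → a ≢ b → Meet ms a b
  strategy⇒meet {ms} S {a} {b} a≢b with S a b a≢b
  ... | t , t≤l , u , v , adj , σu≡a , σv≡b
    rewrite sym (position-placement ms t σu≡a) | sym (position-placement ms t σv≡b) = t , t≤l , adj

  meet⇒strategy : ∀ {ms} → (∀ a b → a ≢ b → Meet ms a b) → IsStrategy G ms
  meet⇒strategy {ms} meet a b a≢b with meet a b a≢b
  ... | t , t≤l , adj = t , t≤l , _ , _ , adj , placement-position ms t a , placement-position ms t b

module _ {n : ℕ} {G H : Graph n} (G⊆H : ∀ {u v} → Adj G u v → Adj H u v) where

  widen : Matching G → Matching H
  widen m = record
    { partner    = partner m
    ; involutive = involutive m
    ; onEdges    = λ v → map₂ G⊆H (onEdges m v)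
    }

  vertexOf-widen : ∀ ms a → vertexOf (map widen ms) a ≡ vertexOf ms a
  vertexOf-widen []       a = refl
  vertexOf-widen (m ∷ ms) a = vertexOf-widen ms (partner m a)

  position-widen : ∀ ms t a → position (map widen ms) t a ≡ position ms t a
  position-widen ms t a =
    trans (cong (λ l → vertexOf l a) (take-map t ms)) (vertexOf-widen (take t ms) a)

  widen-strategy : ∀ {ms} → IsStrategy G ms → IsStrategy H (map widen ms)
  widen-strategy {ms} S = meet⇒strategy λ a b a≢b → meet-widened (strategy⇒meet S a≢b)
    where
    meet-widened : ∀ {a b} → Meet ms a b → Meet (map widen ms) a b
    meet-widened {a} {b} (t , t≤l , adj) =
      t , subst (t ≤_) (sym (length-map widen ms)) t≤l ,
      subst₂ (Adj H) (sym (position-widen ms t a)) (sym (position-widen ms t b)) (G⊆H adj)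

-- Two sides joined by a single edge

always-or-firstFailure : ∀ {Q : ℕ → Set} → Decidable Q → Q 0 → ∀ T →
  (∀ t → t ≤ T → Q t) ⊎ ∃[ t ] (suc t ≤ T × (∀ s → s ≤ t → Q s) × ¬ Q (suc t))
always-or-firstFailure Q? q₀ zero = inj₁ λ { zero z≤n → q₀ }
always-or-firstFailure {Q} Q? q₀ (suc T) with always-or-firstFailure Q? q₀ T
... | inj₂ (t , t<T , holds , fails) = inj₂ (t , m≤n⇒m≤1+n t<T , holds , fails)
... | inj₁ holds with Q? (suc T)
...   | no fails = inj₂ (T , ≤-refl , holds , fails)
...   | yes q = inj₁ holds′
  where
  holds′ : ∀ t → t ≤ suc T → Q t
  holds′ t t≤1+T with m≤n⇒m<n∨m≡n t≤1+T
  ... | inj₁ t<1+T = holds t (≤-pred t<1+T)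
  ... | inj₂ refl  = q

∃-or-∀ : ∀ {n} {P Q : Fin n → Set} → (∀ x → P x ⊎ Q x) → ∃ P ⊎ (∀ x → Q x)
∃-or-∀ {zero}  classify = inj₂ λ ()
∃-or-∀ {suc n} classify with classify Fin.zero | ∃-or-∀ (classify ∘ Fin.suc)
... | inj₁ p₀ | _              = inj₁ (Fin.zero , p₀)
... | inj₂ _  | inj₁ (x , p)   = inj₁ (Fin.suc x , p)
... | inj₂ q₀ | inj₂ q         = inj₂ λ { Fin.zero → q₀ ; (Fin.suc x) → q x }

labelling⇒≤ : ∀ {m N} {Label : Fin m → ℕ → Set} →
  (∀ x → ∃ (Label x)) → (∀ {x c} → Label x c → c < N) →
  (∀ {x y c} → Label x c → Label y c → x ≡ y) → m ≤ N
labelling⇒≤ {m} {N} {Label} label bounded distinct = injective⇒≤ {f = code} code-injective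
  where
  code : Fin m → Fin N
  code x = fromℕ< (bounded (proj₂ (label x)))

  code-injective : Injective _≡_ _≡_ code
  code-injective {x} {y} eq = distinct (proj₂ (label x)) (subst (Label y) (sym same) (proj₂ (label y)))
    where
    same : proj₁ (label x) ≡ proj₁ (label y)
    same = trans (sym (toℕ-fromℕ< _)) (trans (cong toℕ eq) (toℕ-fromℕ< _))

module SingleEdgeCut {n : ℕ} {G : Graph n} {S : Fin n → Set} (S? : Decidable S) {inner outer : Fin n}
  (cut : ∀ {u v} → Adj G u v → S u → ¬ S v → u ≡ inner × v ≡ outer)
  (ms : List (Matching G)) where

  private
    T : ℕ
    T = length ms

    pos : ℕ → Fin n → Fin n
    pos = position ms

  StaysIn : (Fin n → Set) → Fin n → Set
  StaysIn P a = ∀ t → t ≤ T → P (pos t a)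

  LeavesAt : (Fin n → Set) → Fin n → ℕ → Set
  LeavesAt P a t = suc t ≤ T × (∀ s → s ≤ t → P (pos s a)) × ¬ P (pos (suc t) a)

  staysIn-or-leaves : ∀ {P} → Decidable P → ∀ {a} → P a → StaysIn P a ⊎ ∃ (LeavesAt P a)
  staysIn-or-leaves P? {a} a∈P = always-or-firstFailure (λ t → P? (pos t a)) a∈P T

  leaves-via-cut : ∀ {a t} → LeavesAt S a t → pos t a ≡ inner × pos (suc t) a ≡ outer
  leaves-via-cut {a} {t} (t<T , inside , outside) with position-step ms t a t<T
  ... | inj₁ stays = ⊥-elim (outside (subst S (sym stays) (inside t ≤-refl)))
  ... | inj₂ adj   = cut adj (inside t ≤-refl) outside

  enters-via-cut : ∀ {a t} → LeavesAt (¬_ ∘ S) a t → pos t a ≡ outer × pos (suc t) a ≡ inner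
  enters-via-cut {a} {t} (t<T , outside , inside) with position-step ms t a t<T
  ... | inj₁ stays = ⊥-elim (inside (subst (¬_ ∘ S) (sym stays) (outside t ≤-refl)))
  ... | inj₂ adj   = swap (cut (adjSym G adj) (decidable-stable (S? _) inside) (outside t ≤-refl))

  someoneStays-or-allLeave : ∃ (StaysIn S) ⊎ (∀ a → S a → ∃ (LeavesAt S a))
  someoneStays-or-allLeave = ∃-or-∀ classify
    where
    classify : ∀ a → StaysIn S a ⊎ (S a → ∃ (LeavesAt S a))
    classify a with S? a
    ... | no a∉S = inj₂ (⊥-elim ∘ a∉S)
    ... | yes a∈S = map₂ (λ leaves _ → leaves) (staysIn-or-leaves S? a∈S)

  -- Agent i is labelled by its first exit t, and its second copy inj₂ i by t + 1: at t + 1 the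
  -- inner vertex holds an agent that was outside at t, so no first exit happens then.
  module _ {k} (a : Fin k → Fin n) (a-injective : Injective _≡_ _≡_ a)
           (leave : ∀ i → ∃ (LeavesAt S (a i))) where

    data ExitLabel : Fin k ⊎ Fin k → ℕ → Set where
      exit      : ∀ {i t} → LeavesAt S (a i) t → ExitLabel (inj₁ i) t
      afterExit : ∀ {i t} → LeavesAt S (a i) t → ExitLabel (inj₂ i) (suc t)

    exitLabel-bounded : ∀ {j c} → ExitLabel j c → c < suc T
    exitLabel-bounded (exit leaves)      = m≤n⇒m≤1+n (proj₁ leaves)
    exitLabel-bounded (afterExit leaves) = s≤s (proj₁ leaves)

    exit-clash : ∀ {i j t} → LeavesAt S (a i) (suc t) → ¬ LeavesAt S (a j) t
    exit-clash {i} {j} {t} i-leaves@(_ , inside , _) j-leaves@(t<T , _ , outside) =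
      outside (subst S (position-swap ms t t<T i-enters) (inside t (n≤1+n t)))
      where
      i-enters : pos (suc t) (a i) ≡ pos t (a j)
      i-enters = trans (proj₁ (leaves-via-cut i-leaves)) (sym (proj₁ (leaves-via-cut j-leaves)))

    exitLabel-unique : ∀ {u v c} → ExitLabel u c → ExitLabel v c → u ≡ v
    exitLabel-unique {c = t} (exit p) (exit q) = cong inj₁ (a-injective (position-injective ms t
      (trans (proj₁ (leaves-via-cut p)) (sym (proj₁ (leaves-via-cut q))))))
    exitLabel-unique {c = t} (afterExit p) (afterExit q) = cong inj₂ (a-injective (position-injective ms t
      (trans (proj₂ (leaves-via-cut p)) (sym (proj₂ (leaves-via-cut q))))))
    exitLabel-unique (exit p) (afterExit q) = ⊥-elim (exit-clash p q)
    exitLabel-unique (afterExit p) (exit q) = ⊥-elim (exit-clash q p)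

    leavers-bound : k + k ≤ suc T
    leavers-bound = labelling⇒≤ {Label = ExitLabel ∘ splitAt k} label exitLabel-bounded
      (λ p q → trans (sym (join-splitAt k k _)) (trans (cong (join k k) (exitLabel-unique p q)) (join-splitAt k k _)))
      where
      label : ∀ j → ∃ (ExitLabel (splitAt k j))
      label j with splitAt k j
      ... | inj₁ i = let (t , leaves) = leave i in t , exit leaves
      ... | inj₂ i = let (t , leaves) = leave i in suc t , afterExit leaves

  -- Given a₀ always in S and b₀ always outside, label each agent by a moment at which it stands at
  -- the cut edge: leavers by their crossing, stayers by their meeting with b₀ (resp. a₀) across
  -- the cut, and b₀ by the spare moment T + 1.  The agent on outer is used only when a₀ is on
  -- inner and b₀ is not on outer, so no moment labels two agents.
  module _ (strategy : IsStrategy G ms) {a₀ b₀ : Fin n}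
           (a₀-stays : StaysIn S a₀) (b₀-stays : StaysIn (¬_ ∘ S) b₀) where

    data CutLabel : Fin n → ℕ → Set where
      atInner : ∀ {x c} → c ≤ T → pos c x ≡ inner → x ≢ a₀ ⊎ pos c b₀ ≡ outer → CutLabel x c
      atOuter : ∀ {x c} → c ≤ T → pos c a₀ ≡ inner → pos c x ≡ outer → x ≢ b₀ → CutLabel x c
      lastly  : CutLabel b₀ (suc T)

    cutLabel : ∀ x → ∃ (CutLabel x)
    cutLabel x with S? x
    ... | yes x∈S with staysIn-or-leaves S? x∈S
    ...   | inj₂ (t , leaves@(t<T , _ , outside)) =
            t , atInner (<⇒≤ t<T) (proj₁ (leaves-via-cut leaves))
                        (inj₁ λ { refl → outside (a₀-stays (suc t) t<T) })
    ...   | inj₁ stays with strategy⇒meet strategy {x} {b₀} (λ { refl → b₀-stays 0 z≤n x∈S })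
    ...     | c , c≤T , adj = let (x-in , b₀-out) = cut adj (stays c c≤T) (b₀-stays c c≤T) in
                              c , atInner c≤T x-in (inj₂ b₀-out)
    cutLabel x | no x∉S with x ≟ᶠ b₀
    ... | yes refl = suc T , lastly
    ... | no x≢b₀ with staysIn-or-leaves (¬? ∘ S?) x∉S
    ...   | inj₂ (t , enters) =
            suc t , atInner (proj₁ enters) (proj₂ (enters-via-cut enters))
                            (inj₁ λ { refl → x∉S (a₀-stays 0 z≤n) })
    ...   | inj₁ stays with strategy⇒meet strategy {a₀} {x} (λ { refl → x∉S (a₀-stays 0 z≤n) })
    ...     | c , c≤T , adj = let (a₀-in , x-out) = cut adj (a₀-stays c c≤T) (stays c c≤T) in
                              c , atOuter c≤T a₀-in x-out x≢b₀

    cutLabel-bounded : ∀ {x c} → CutLabel x c → c < suc (suc T)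
    cutLabel-bounded (atInner c≤T _ _)   = s≤s (m≤n⇒m≤1+n c≤T)
    cutLabel-bounded (atOuter c≤T _ _ _) = s≤s (m≤n⇒m≤1+n c≤T)
    cutLabel-bounded lastly              = ≤-refl

    inner-outer-clash : ∀ {x y c} → pos c x ≡ inner → x ≢ a₀ ⊎ pos c b₀ ≡ outer →
                        pos c a₀ ≡ inner → pos c y ≡ outer → y ≢ b₀ → ⊥
    inner-outer-clash {c = c} x-in side a₀-in y-out y≢b₀
      with position-injective ms c (trans x-in (sym a₀-in)) | side
    ... | refl | inj₁ x≢a₀  = x≢a₀ refl
    ... | refl | inj₂ b₀-out = y≢b₀ (position-injective ms c (trans y-out (sym b₀-out)))

    cutLabel-unique : ∀ {x y c} → CutLabel x c → CutLabel y c → x ≡ y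
    cutLabel-unique {c = c} (atInner _ x-in _) (atInner _ y-in _) =
      position-injective ms c (trans x-in (sym y-in))
    cutLabel-unique {c = c} (atOuter _ _ x-out _) (atOuter _ _ y-out _) =
      position-injective ms c (trans x-out (sym y-out))
    cutLabel-unique lastly lastly = refl
    cutLabel-unique {c = c} (atInner _ x-in side) (atOuter _ a₀-in y-out y≢b₀) =
      ⊥-elim (inner-outer-clash {c = c} x-in side a₀-in y-out y≢b₀)
    cutLabel-unique {c = c} (atOuter _ a₀-in x-out x≢b₀) (atInner _ y-in side) =
      ⊥-elim (inner-outer-clash {c = c} y-in side a₀-in x-out x≢b₀)
    cutLabel-unique (atInner T<T _ _)   lastly = ⊥-elim (1+n≰n T<T)
    cutLabel-unique (atOuter T<T _ _ _) lastly = ⊥-elim (1+n≰n T<T)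
    cutLabel-unique lastly (atInner T<T _ _)   = ⊥-elim (1+n≰n T<T)
    cutLabel-unique lastly (atOuter T<T _ _ _) = ⊥-elim (1+n≰n T<T)

    stayers-bound : n ≤ suc (suc T)
    stayers-bound = labelling⇒≤ cutLabel cutLabel-bounded cutLabel-unique

-- The barbell

⌈n/2⌉≤1+⌊n/2⌋ : ∀ n → ⌈ n /2⌉ ≤ suc ⌊ n /2⌋
⌈n/2⌉≤1+⌊n/2⌋ n = ⌊n/2⌋-mono (n≤1+n (suc n))

module _ (n : ℕ) where

  leftAgent : Fin ⌈ n /2⌉ → Fin n
  leftAgent i = inject≤ i (⌈n/2⌉≤n n)

  rightAgent : Fin ⌊ n /2⌋ → Fin n
  rightAgent i = cast (trans (+-comm ⌈ n /2⌉ ⌊ n /2⌋) (⌊n/2⌋+⌈n/2⌉≡n n)) (⌈ n /2⌉ ↑ʳ i)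

  toℕ-rightAgent : ∀ i → toℕ (rightAgent i) ≡ ⌈ n /2⌉ + toℕ i
  toℕ-rightAgent i = trans (toℕ-cast _ (⌈ n /2⌉ ↑ʳ i)) (toℕ-↑ʳ ⌈ n /2⌉ i)

  leftAgent-inFirst : ∀ i → InFirst (leftAgent i)
  leftAgent-inFirst i = subst (_< ⌈ n /2⌉) (sym (toℕ-inject≤ i _)) (toℕ<n i)

  rightAgent-inSecond : ∀ i → InSecond (rightAgent i)
  rightAgent-inSecond i = subst (⌈ n /2⌉ ≤_) (sym (toℕ-rightAgent i)) (m≤m+n ⌈ n /2⌉ (toℕ i))

module _ (m : ℕ) where

  private
    n = suc (suc m)

    ⌈m/2⌉<n : ⌈ m /2⌉ < n
    ⌈m/2⌉<n = s≤s (m≤n⇒m≤1+n (⌈n/2⌉≤n m))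

  -- ⌈ n /2⌉ reduces to suc ⌈ m /2⌉, so these are the vertices ⌈ n /2⌉ - 1 and ⌈ n /2⌉
  bridgeL bridgeR : Fin n
  bridgeL = fromℕ< ⌈m/2⌉<n
  bridgeR = fromℕ< (⌈n/2⌉<n m)

  barbell-cut : ∀ {u v : Fin n} → BarbellAdj u v → InFirst u → ¬ InFirst v → u ≡ bridgeL × v ≡ bridgeR
  barbell-cut (inj₁ (_ , inj₁ (_ , v∈L))) _ v∉L = ⊥-elim (v∉L v∈L)
  barbell-cut (inj₁ (_ , inj₂ (u∈R , _))) u∈L _ = ⊥-elim (<⇒≱ u∈L u∈R)
  barbell-cut (inj₂ (inj₂ (_ , u≡K))) u∈L _     = ⊥-elim (<⇒≢ u∈L u≡K)
  barbell-cut (inj₂ (inj₁ (1+u≡K , v≡K))) _ _   =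
    toℕ-injective (trans (suc-injective 1+u≡K) (sym (toℕ-fromℕ< ⌈m/2⌉<n))) ,
    toℕ-injective (trans v≡K (sym (toℕ-fromℕ< (⌈n/2⌉<n m))))

  barbell-cutʳ : ∀ {u v : Fin n} → BarbellAdj u v → InSecond u → ¬ InSecond v → u ≡ bridgeR × v ≡ bridgeL
  barbell-cutʳ adj u∈R v∉R = swap (barbell-cut (adjSym (barbellGraph n) adj) (≰⇒> v∉R) (≤⇒≯ u∈R))

  private
    module Left  = SingleEdgeCut {G = barbellGraph n} (λ v → toℕ v <? ⌈ n /2⌉) barbell-cut
    module Right = SingleEdgeCut {G = barbellGraph n} (λ v → ⌈ n /2⌉ ≤? toℕ v) barbell-cutʳ

  barbell-≤ : ∀ ms → IsStrategy (barbellGraph n) ms → n ≤ suc (suc (length ms))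
  barbell-≤ ms strategy with Left.someoneStays-or-allLeave ms | Right.someoneStays-or-allLeave ms
  ... | inj₁ (a₀ , a₀-stays) | inj₁ (b₀ , b₀-stays) =
    Left.stayers-bound ms strategy a₀-stays (λ t t≤T → ≤⇒≯ (b₀-stays t t≤T))
  ... | inj₂ allLeave | _ = begin
    n                          ≡⟨ ⌊n/2⌋+⌈n/2⌉≡n n ⟨
    ⌊ n /2⌋ + ⌈ n /2⌉          ≤⟨ +-monoˡ-≤ ⌈ n /2⌉ (⌊n/2⌋≤⌈n/2⌉ n) ⟩
    ⌈ n /2⌉ + ⌈ n /2⌉          ≤⟨ Left.leavers-bound ms (leftAgent n) (inject≤-injective _ _ _ _)
                                    (λ i → allLeave (leftAgent n i) (leftAgent-inFirst n i)) ⟩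
    suc (length ms)            ≤⟨ n≤1+n _ ⟩
    suc (suc (length ms))      ∎
    where open ≤-Reasoning
  ... | _ | inj₂ allLeave = begin
    n                          ≡⟨ ⌊n/2⌋+⌈n/2⌉≡n n ⟨
    ⌊ n /2⌋ + ⌈ n /2⌉          ≤⟨ +-monoʳ-≤ ⌊ n /2⌋ (⌈n/2⌉≤1+⌊n/2⌋ n) ⟩
    ⌊ n /2⌋ + suc ⌊ n /2⌋      ≡⟨ +-suc ⌊ n /2⌋ ⌊ n /2⌋ ⟩
    suc (⌊ n /2⌋ + ⌊ n /2⌋)    ≤⟨ s≤s (Right.leavers-bound ms (rightAgent n) rightAgent-injective
                                    (λ i → allLeave (rightAgent n i) (rightAgent-inSecond n i))) ⟩
    suc (suc (length ms))      ∎
    where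
    open ≤-Reasoning
    rightAgent-injective : ∀ {i j} → rightAgent n i ≡ rightAgent n j → i ≡ j
    rightAgent-injective {i} {j} eq = toℕ-injective (+-cancelˡ-≡ ⌈ n /2⌉ _ _
      (trans (sym (toℕ-rightAgent n i)) (trans (cong toℕ eq) (toℕ-rightAgent n j))))

barbell-lowerBound : ∀ {n} ms → IsStrategy (barbellGraph n) ms → n ∸ 2 ≤ length ms
barbell-lowerBound {zero}          ms _        = z≤n
barbell-lowerBound {suc zero}      ms _        = z≤n
barbell-lowerBound {suc (suc m)}   ms strategy = ≤-pred (≤-pred (barbell-≤ m ms strategy))

successor⇒barbellAdj : ∀ {n} {u v : Fin n} → suc (toℕ u) ≡ toℕ v → BarbellAdj u v
successor⇒barbellAdj {n} {u} {v} 1+u≡v with <-≤-connex (toℕ v) ⌈ n /2⌉ | <-≤-connex (toℕ u) ⌈ n /2⌉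
... | inj₁ v∈L | _        = inj₁ ((λ { refl → 1+n≢n 1+u≡v }) , inj₁ (<-trans (≤-reflexive 1+u≡v) v∈L , v∈L))
... | inj₂ v∈R | inj₂ u∈R = inj₁ ((λ { refl → 1+n≢n 1+u≡v }) , inj₂ (u∈R , v∈R))
... | inj₂ v∈R | inj₁ u∈L = inj₂ (inj₁ (1+u≡K , trans (sym 1+u≡v) 1+u≡K))
  where 1+u≡K = ≤-antisym u∈L (subst (⌈ n /2⌉ ≤_) (sym 1+u≡v) v∈R)

path⊆barbell : ∀ {n} {u v : Fin n} → PathAdj u v → BarbellAdj u v
path⊆barbell (inj₁ 1+u≡v) = successor⇒barbellAdj 1+u≡v
path⊆barbell (inj₂ 1+v≡u) = adjSym (barbellGraph _) (successor⇒barbellAdj 1+v≡u)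

path-lowerBound : ∀ {n} ms → IsStrategy (pathGraph n) ms → n ∸ 2 ≤ length ms
path-lowerBound ms strategy = subst (_ ≤_) (length-map (widen path⊆barbell) ms)
  (barbell-lowerBound _ (widen-strategy path⊆barbell strategy))

-- Alternating swaps on the path

odd : ℕ → Bool
odd zero    = false
odd (suc n) = not (odd n)

odd-+ : ∀ m n → odd (m + n) ≡ odd m xor odd n
odd-+ zero    n = refl
odd-+ (suc m) n = trans (cong not (odd-+ m n)) (not-distribˡ-xor (odd m) (odd n))

odd-double : ∀ n → odd (n + n) ≡ false
odd-double n = trans (odd-+ n n) (xor-same (odd n))

odd-+-double : ∀ m n → odd (m + (n + n)) ≡ odd m
odd-+-double m n = trans (odd-+ m (n + n)) (trans (cong (odd m xor_) (odd-double n)) (xor-identityʳ (odd m)))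

odd-sum-double : ∀ {m n k} → m + n ≡ k + k → odd m ≡ odd n
odd-sum-double {m} {n} {k} eq = xor-false (trans (sym (odd-+ m n)) (trans (cong odd eq) (odd-double k)))
  where
  xor-false : ∀ {x y} → x xor y ≡ false → x ≡ y
  xor-false {false} {false} _ = refl
  xor-false {true}  {true}  _ = refl

not-≢ : ∀ {x y} → x ≡ y → not x ≢ y
not-≢ {true}  refl ()
not-≢ {false} refl ()

path-position-step : ∀ {N} (ms : List (Matching (pathGraph N))) t a → suc t ≤ length ms →
            toℕ (position ms (suc t) a) ≤ suc (toℕ (position ms t a)) ×
            toℕ (position ms t a) ≤ suc (toℕ (position ms (suc t) a))
path-position-step ms t a t<T with position-step ms t a t<T
... | inj₁ stays        = ≤-trans (≤-reflexive (cong toℕ stays)) (n≤1+n _) ,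
                         ≤-trans (≤-reflexive (cong toℕ (sym stays))) (n≤1+n _)
... | inj₂ (inj₁ up)   = ≤-reflexive (sym up) , ≤-trans (n≤1+n _) (≤-trans (≤-reflexive up) (n≤1+n _))
... | inj₂ (inj₂ down) = ≤-trans (n≤1+n _) (≤-trans (≤-reflexive down) (n≤1+n _)) , ≤-reflexive (sym down)

overtaking⇒adjacent : ∀ {N} (ms : List (Matching (pathGraph N))) {a b} T → T ≤ length ms →
  toℕ a < toℕ b → toℕ (position ms T b) < toℕ (position ms T a) →
  ∃[ t ] (t < T × suc (toℕ (position ms t a)) ≡ toℕ (position ms t b))
overtaking⇒adjacent ms zero _ a<b b<a = ⊥-elim (<-asym a<b b<a)
overtaking⇒adjacent ms {a} {b} (suc T) T<l a<b overtaken
  with toℕ (position ms T b) <? toℕ (position ms T a)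
... | yes earlier with overtaking⇒adjacent ms T (<⇒≤ T<l) a<b earlier
...   | t , t<T , adjacent = t , m<n⇒m<1+n t<T , adjacent
overtaking⇒adjacent ms {a} {b} (suc T) T<l a<b overtaken | no not-yet =
  T , ≤-refl , ≤-antisym behind (begin
    toℕ (position ms T b)             ≤⟨ proj₂ (path-position-step ms T b T<l) ⟩
    suc (toℕ (position ms (suc T) b)) ≤⟨ overtaken ⟩
    toℕ (position ms (suc T) a)       ≤⟨ proj₁ (path-position-step ms T a T<l) ⟩
    suc (toℕ (position ms T a))       ∎)
  where
  open ≤-Reasoning
  behind : suc (toℕ (position ms T a)) ≤ toℕ (position ms T b)
  behind = ≤∧≢⇒< (≮⇒≥ not-yet) λ same → <⇒≢ a<b (cong toℕ (position-injective ms T (toℕ-injective same)))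

module Sweep (N : ℕ) where

  alternatingPartner : Bool → ℕ → ℕ
  alternatingPartner b v with odd v ≟ᵇ b | suc v <? N
  ... | yes _ | yes _ = suc v
  ... | yes _ | no _  = v
  ... | no _  | _     = pred v

  alternatingPartner-up : ∀ {b} v → odd v ≡ b → suc v < N → alternatingPartner b v ≡ suc v
  alternatingPartner-up {b} v odd≡b 1+v<N with odd v ≟ᵇ b | suc v <? N
  ... | yes _ | yes _    = refl
  ... | yes _ | no 1+v≮N = ⊥-elim (1+v≮N 1+v<N)
  ... | no odd≢b | _     = ⊥-elim (odd≢b odd≡b)

  alternatingPartner-top : ∀ {b} v → odd v ≡ b → ¬ suc v < N → alternatingPartner b v ≡ v
  alternatingPartner-top {b} v odd≡b 1+v≮N with odd v ≟ᵇ b | suc v <? N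
  ... | yes _ | yes 1+v<N = ⊥-elim (1+v≮N 1+v<N)
  ... | yes _ | no _      = refl
  ... | no odd≢b | _      = ⊥-elim (odd≢b odd≡b)

  alternatingPartner-down : ∀ {b} v → odd v ≢ b → alternatingPartner b v ≡ pred v
  alternatingPartner-down {b} v odd≢b with odd v ≟ᵇ b | suc v <? N
  ... | yes odd≡b | _ = ⊥-elim (odd≢b odd≡b)
  ... | no _      | _ = refl

  alternatingPartner-< : ∀ b {v} → v < N → alternatingPartner b v < N
  alternatingPartner-< b {v} v<N with odd v ≟ᵇ b | suc v <? N
  ... | yes _ | yes 1+v<N = 1+v<N
  ... | yes _ | no _      = v<N
  ... | no _  | _         = ≤-<-trans pred[n]≤n v<N

  alternatingPartner-involutive : ∀ b {v} → v < N → alternatingPartner b (alternatingPartner b v) ≡ v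
  alternatingPartner-involutive b {v} v<N with odd v ≟ᵇ b | suc v <? N
  ... | yes odd≡b | yes _    = alternatingPartner-down (suc v) (not-≢ odd≡b)
  ... | yes odd≡b | no 1+v≮N = alternatingPartner-top v odd≡b 1+v≮N
  alternatingPartner-involutive b {zero}  v<N | no odd≢b | _ = alternatingPartner-down zero odd≢b
  alternatingPartner-involutive b {suc w} v<N | no odd≢b | _ =
    alternatingPartner-up w (not-injective (¬-not odd≢b)) v<N

  alternatingPartner-moves : ∀ b v → alternatingPartner b v ≡ v
                                   ⊎ suc v ≡ alternatingPartner b v ⊎ suc (alternatingPartner b v) ≡ v
  alternatingPartner-moves b v with odd v ≟ᵇ b | suc v <? N
  ... | yes _ | yes _ = inj₂ (inj₁ refl)
  ... | yes _ | no _  = inj₁ refl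
  alternatingPartner-moves b zero    | no _ | _ = inj₁ refl
  alternatingPartner-moves b (suc w) | no _ | _ = inj₂ (inj₂ refl)

  alternatingᶠ : Bool → Fin N → Fin N
  alternatingᶠ b v = fromℕ< (alternatingPartner-< b (toℕ<n v))

  toℕ-alternatingᶠ : ∀ b v → toℕ (alternatingᶠ b v) ≡ alternatingPartner b (toℕ v)
  toℕ-alternatingᶠ b v = toℕ-fromℕ< (alternatingPartner-< b (toℕ<n v))

  alternating : Bool → Matching (pathGraph N)
  alternating b = record
    { partner    = alternatingᶠ b
    ; involutive = λ v → toℕ-injective (begin
        toℕ (alternatingᶠ b (alternatingᶠ b v))
          ≡⟨ toℕ-alternatingᶠ b (alternatingᶠ b v) ⟩
        alternatingPartner b (toℕ (alternatingᶠ b v))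
          ≡⟨ cong (alternatingPartner b) (toℕ-alternatingᶠ b v) ⟩
        alternatingPartner b (alternatingPartner b (toℕ v))
          ≡⟨ alternatingPartner-involutive b (toℕ<n v) ⟩
        toℕ v                                              ∎)
    ; onEdges    = λ v → onEdge v (alternatingPartner-moves b (toℕ v))
    }
    where
    open ≡-Reasoning
    onEdge : ∀ v → let w = alternatingPartner b (toℕ v) in
             w ≡ toℕ v ⊎ suc (toℕ v) ≡ w ⊎ suc w ≡ toℕ v → alternatingᶠ b v ≡ v ⊎ PathAdj v (alternatingᶠ b v)
    onEdge v (inj₁ fixed)        = inj₁ (toℕ-injective (trans (toℕ-alternatingᶠ b v) fixed))
    onEdge v (inj₂ (inj₁ up))    = inj₂ (inj₁ (trans up (sym (toℕ-alternatingᶠ b v))))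
    onEdge v (inj₂ (inj₂ down))  = inj₂ (inj₂ (trans (cong suc (toℕ-alternatingᶠ b v)) down))

  sweep : ℕ → ℕ → List (Matching (pathGraph N))
  sweep s zero    = []
  sweep s (suc j) = alternating (odd s) ∷ sweep (suc s) j

  length-sweep : ∀ s j → length (sweep s j) ≡ j
  length-sweep s zero    = refl
  length-sweep s (suc j) = cong suc (length-sweep (suc s) j)

  take-sweep : ∀ s {t j} → t ≤ j → take t (sweep s j) ≡ sweep s t
  take-sweep s {zero}  _         = refl
  take-sweep s {suc t} (s≤s t≤j) = cong (alternating (odd s) ∷_) (take-sweep (suc s) t≤j)

  vertexOf-sweep : ∀ s t a → vertexOf (sweep s (suc t)) a ≡ alternatingᶠ (odd (s + t)) (vertexOf (sweep s t) a)
  vertexOf-sweep s zero    a = cong (λ k → alternatingᶠ (odd k) a) (sym (+-identityʳ s))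
  vertexOf-sweep s (suc t) a = trans (vertexOf-sweep (suc s) t (alternatingᶠ (odd s) a))
    (cong (λ k → alternatingᶠ (odd k) (vertexOf (sweep s (suc t)) a)) (sym (+-suc s t)))

  -- the back-and-forth walk 0, 1, …, N − 1, N − 1, …, 1, 0, 0, 1, …, valid below 3N
  zigzag : ℕ → ℕ
  zigzag u with u <? N | u <? N + N
  ... | yes _ | _     = u
  ... | no _  | yes _ = N + N ∸ suc u
  ... | no _  | no _  = u ∸ (N + N)

  zigzag-low : ∀ {u} → u < N → zigzag u ≡ u
  zigzag-low {u} u<N with u <? N | u <? N + N
  ... | yes _  | _ = refl
  ... | no u≮N | _ = ⊥-elim (u≮N u<N)

  zigzag-mid : ∀ {u} → N ≤ u → u < N + N → zigzag u ≡ N + N ∸ suc u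
  zigzag-mid {u} N≤u u<2N with u <? N | u <? N + N
  ... | yes u<N | _       = ⊥-elim (<⇒≱ u<N N≤u)
  ... | no _    | yes _   = refl
  ... | no _    | no u≮2N = ⊥-elim (u≮2N u<2N)

  zigzag-high : ∀ {u} → N + N ≤ u → zigzag u ≡ u ∸ (N + N)
  zigzag-high {u} 2N≤u with u <? N | u <? N + N
  ... | yes u<N | _        = ⊥-elim (<⇒≱ u<N (≤-trans (m≤m+n N N) 2N≤u))
  ... | no _    | yes u<2N = ⊥-elim (<⇒≱ u<2N 2N≤u)
  ... | no _    | no _     = refl

  zigzag-step-low : ∀ {u} → u < N → alternatingPartner (odd u) (zigzag u) ≡ zigzag (suc u)
  zigzag-step-low {u} u<N rewrite zigzag-low u<N with m≤n⇒m<n∨m≡n u<N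
  ... | inj₁ 1+u<N = trans (alternatingPartner-up u refl 1+u<N) (sym (zigzag-low 1+u<N))
  ... | inj₂ 1+u≡N = begin
    alternatingPartner (odd u) u ≡⟨ alternatingPartner-top u refl (<-irrefl 1+u≡N) ⟩
    u                            ≡⟨ cong pred 1+u≡N ⟩
    pred N                       ≡⟨ cong pred (m+n∸n≡m N N) ⟨
    pred (N + N ∸ N)             ≡⟨ pred[m∸n]≡m∸[1+n] (N + N) N ⟩
    N + N ∸ suc N                ≡⟨ cong (λ k → N + N ∸ suc k) 1+u≡N ⟨
    N + N ∸ suc (suc u)          ≡⟨ zigzag-mid (≤-reflexive (sym 1+u≡N)) 1+u<2N ⟨
    zigzag (suc u)               ∎
    where
    open ≡-Reasoning
    1+u<2N : suc u < N + N
    1+u<2N = subst (λ k → suc u < k + k) 1+u≡N (m<m+n (suc u) z<s)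

  reflection-parity : ∀ {u} → u < N + N → odd (N + N ∸ suc u) ≢ odd u
  reflection-parity {u} u<2N same = not-≢ refl (trans (sym (odd-sum-double {k = N} (m∸n+n≡m u<2N))) same)

  zigzag-step-mid : ∀ {u} → N ≤ u → u < N + N → alternatingPartner (odd u) (zigzag u) ≡ zigzag (suc u)
  zigzag-step-mid {u} N≤u u<2N = begin
    alternatingPartner (odd u) (zigzag u)      ≡⟨ cong (alternatingPartner (odd u)) (zigzag-mid N≤u u<2N) ⟩
    alternatingPartner (odd u) (N + N ∸ suc u) ≡⟨ alternatingPartner-down (N + N ∸ suc u) (reflection-parity u<2N) ⟩
    pred (N + N ∸ suc u)                       ≡⟨ pred[m∸n]≡m∸[1+n] (N + N) (suc u) ⟩
    N + N ∸ suc (suc u)                        ≡⟨ next ⟩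
    zigzag (suc u)                             ∎
    where
    open ≡-Reasoning
    next : N + N ∸ suc (suc u) ≡ zigzag (suc u)
    next with m≤n⇒m<n∨m≡n u<2N
    ... | inj₁ 1+u<2N = sym (zigzag-mid (m≤n⇒m≤1+n N≤u) 1+u<2N)
    ... | inj₂ 1+u≡2N = begin
      N + N ∸ suc (suc u) ≡⟨ m≤n⇒m∸n≡0 (≤-trans (≤-reflexive (sym 1+u≡2N)) (n≤1+n (suc u))) ⟩
      0                   ≡⟨ m≤n⇒m∸n≡0 (≤-reflexive 1+u≡2N) ⟨
      suc u ∸ (N + N)     ≡⟨ zigzag-high (≤-reflexive (sym 1+u≡2N)) ⟨
      zigzag (suc u)      ∎

  zigzag-step-high : ∀ {u} → N + N ≤ u → suc u < N + (N + N) →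
                     alternatingPartner (odd u) (zigzag u) ≡ zigzag (suc u)
  zigzag-step-high {u} 2N≤u 1+u<3N = begin
    alternatingPartner (odd u) (zigzag u)     ≡⟨ cong (alternatingPartner (odd u)) (zigzag-high 2N≤u) ⟩
    alternatingPartner (odd u) (u ∸ (N + N))  ≡⟨ alternatingPartner-up (u ∸ (N + N)) parity 1+r<N ⟩
    suc (u ∸ (N + N))                         ≡⟨ +-∸-assoc 1 2N≤u ⟨
    suc u ∸ (N + N)                           ≡⟨ zigzag-high (m≤n⇒m≤1+n 2N≤u) ⟨
    zigzag (suc u)                            ∎
    where
    open ≡-Reasoning
    r+2N≡u : u ∸ (N + N) + (N + N) ≡ u
    r+2N≡u = m∸n+n≡m 2N≤u
    parity : odd (u ∸ (N + N)) ≡ odd u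
    parity = trans (sym (odd-+-double (u ∸ (N + N)) N)) (cong odd r+2N≡u)
    1+r<N : suc (u ∸ (N + N)) < N
    1+r<N = +-cancelʳ-< (N + N) _ N (subst (_< N + (N + N)) (sym (cong suc r+2N≡u)) 1+u<3N)

  zigzag-step : ∀ u → suc u < N + (N + N) → alternatingPartner (odd u) (zigzag u) ≡ zigzag (suc u)
  zigzag-step u 1+u<3N with <-≤-connex u N | <-≤-connex u (N + N)
  ... | inj₁ u<N | _        = zigzag-step-low u<N
  ... | inj₂ N≤u | inj₁ u<2N = zigzag-step-mid N≤u u<2N
  ... | inj₂ _   | inj₂ 2N≤u = zigzag-step-high 2N≤u 1+u<3N

  -- even agents enter the walk at its beginning, odd agents on its way back
  start : ℕ → ℕ
  start a = if odd a then N + N ∸ suc a else a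

  start-parity : ∀ {a} → a < N → odd (start a) ≡ false
  start-parity {a} a<N with odd a in odd[a]
  ... | false = odd[a]
  ... | true  = trans (odd-sum-double {k = N} (m∸n+n≡m (≤-trans a<N (m≤m+n N N)))) (cong not odd[a])

  start<2N : ∀ {a} → a < N → start a < N + N
  start<2N {a} a<N with odd a
  ... | false = <-≤-trans a<N (m≤m+n N N)
  ... | true  = ∸-monoʳ-< z<s (≤-trans a<N (m≤m+n N N))

  zigzag-start : ∀ {a} → a < N → zigzag (start a) ≡ a
  zigzag-start {a} a<N with odd a
  ... | false = zigzag-low a<N
  ... | true  = begin
    zigzag (N + N ∸ suc a)           ≡⟨ zigzag-mid (m+n≤o⇒m≤o∸n N (+-monoʳ-≤ N a<N)) (∸-monoʳ-< z<s 1+a≤2N) ⟩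
    N + N ∸ suc (N + N ∸ suc a)      ≡⟨ pred[m∸n]≡m∸[1+n] (N + N) _ ⟨
    pred (N + N ∸ (N + N ∸ suc a))   ≡⟨ cong pred (m∸[m∸n]≡n 1+a≤2N) ⟩
    a                                ∎
    where
    open ≡-Reasoning
    1+a≤2N : suc a ≤ N + N
    1+a≤2N = ≤-trans a<N (m≤m+n N N)

  toℕ-vertexOf-sweep : ∀ t (a : Fin N) → t < N → toℕ (vertexOf (sweep 0 t) a) ≡ zigzag (start (toℕ a) + t)
  toℕ-vertexOf-sweep zero    a _     = sym (trans (cong zigzag (+-identityʳ _)) (zigzag-start (toℕ<n a)))
  toℕ-vertexOf-sweep (suc t) a 1+t<N = begin
    toℕ (vertexOf (sweep 0 (suc t)) a)         ≡⟨ cong toℕ (vertexOf-sweep 0 t a) ⟩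
    toℕ (alternatingᶠ (odd t) v)               ≡⟨ toℕ-alternatingᶠ (odd t) v ⟩
    alternatingPartner (odd t) (toℕ v)         ≡⟨ cong (alternatingPartner (odd t)) (toℕ-vertexOf-sweep t a t<N) ⟩
    alternatingPartner (odd t) (zigzag u)      ≡⟨ cong (λ b → alternatingPartner b (zigzag u)) parity ⟨
    alternatingPartner (odd u) (zigzag u)      ≡⟨ zigzag-step u 1+u<3N ⟩
    zigzag (suc u)                             ≡⟨ cong zigzag (+-suc (start (toℕ a)) t) ⟨
    zigzag (start (toℕ a) + suc t)             ∎
    where
    open ≡-Reasoning
    v = vertexOf (sweep 0 t) a
    t<N = <-trans (n<1+n t) 1+t<N
    u = start (toℕ a) + t
    parity : odd u ≡ odd t
    parity = trans (odd-+ (start (toℕ a)) t) (cong (_xor odd t) (start-parity (toℕ<n a)))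
    1+u<3N : suc u < N + (N + N)
    1+u<3N = subst₂ _<_ (+-suc (start (toℕ a)) t) (+-comm (N + N) N) (+-mono-< (start<2N (toℕ<n a)) 1+t<N)

oddBit : ℕ → ℕ
oddBit a = if odd a then 1 else 0

parity-gap : ∀ {a b} → suc (suc a) ≤ b → a + oddBit a + 2 ≤ b + oddBit b
parity-gap {a} {b} gap with odd a in odd[a] | odd b in odd[b]
... | false | p     = subst (_≤ b + (if p then 1 else 0)) (rearrange a) (≤-trans gap (m≤m+n b _))
  where
  rearrange : ∀ a → suc (suc a) ≡ a + 0 + 2
  rearrange = solve-∀
... | true  | true  = subst (_≤ b + 1) (rearrange a) (+-monoˡ-≤ 1 gap)
  where
  rearrange : ∀ a → suc (suc a) + 1 ≡ a + 1 + 2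
  rearrange = solve-∀
... | true  | false = subst₂ _≤_ (rearrange a) (sym (+-identityʳ b)) (≤∧≢⇒< gap same-parity)
  where
  rearrange : ∀ a → suc (suc (suc a)) ≡ a + 1 + 2
  rearrange = solve-∀
  same-parity : suc (suc a) ≢ b
  same-parity refl with trans (sym odd[a]) (trans (sym (not-involutive (odd a))) odd[b])
  ... | ()

module _ (m : ℕ) where
  open Sweep (suc (suc m))

  private
    N : ℕ
    N = suc (suc m)

  finalPosition : ℕ → ℕ
  finalPosition a = zigzag (start a + m)

  -- finalPosition a + a would be m + 1 if the order of the agents were exactly reversed
  excess : ℕ → ℕ
  excess a = finalPosition a + a + oddBit a

  private
    ≡m⇒bounded : ∀ {e} → e ≡ m → m ≤ e × e ≤ suc N
    ≡m⇒bounded refl = ≤-refl , m≤n+m m 3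

    ≡3+m⇒bounded : ∀ {e} → e ≡ suc N → m ≤ e × e ≤ suc N
    ≡3+m⇒bounded refl = m≤n+m m 3 , ≤-refl

    excess-zero : m ≤ zigzag m + 0 + 0 × zigzag m + 0 + 0 ≤ suc N
    excess-zero =
      ≡m⇒bounded (trans (+-identityʳ _) (trans (+-identityʳ _) (zigzag-low (m<n⇒m<1+n (n<1+n m)))))

    -- an even agent a ≥ 2 has already turned at the end of the path
    excess-even : ∀ a → suc (suc a) < N →
                  m ≤ zigzag (suc (suc a) + m) + suc (suc a) + 0 × zigzag (suc (suc a) + m) + suc (suc a) + 0 ≤ suc N
    excess-even a a<N = ≡3+m⇒bounded (+-cancelʳ-≡ (suc m) _ _ (begin
      zigzag u + suc (suc a) + 0 + suc m ≡⟨ rearrange (zigzag u) a m ⟩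
      zigzag u + suc u                   ≡⟨ cong (_+ suc u) (zigzag-mid N≤u u<2N) ⟩
      N + N ∸ suc u + suc u              ≡⟨ m∸n+n≡m u<2N ⟩
      N + N                              ≡⟨ solve-∀′ m ⟩
      suc N + suc m                      ∎))
      where
      open ≡-Reasoning
      u = suc (suc a) + m
      N≤u : N ≤ u
      N≤u = s≤s (s≤s (m≤n+m m a))
      u<2N : u < N + N
      u<2N = +-mono-< a<N (m<n⇒m<1+n (n<1+n m))
      rearrange : ∀ z a m → z + suc (suc a) + 0 + suc m ≡ z + suc (suc (suc a) + m)
      rearrange = solve-∀
      solve-∀′ : ∀ m → suc (suc m) + suc (suc m) ≡ suc (suc (suc m)) + suc m
      solve-∀′ = solve-∀

    -- an odd agent a < m has already turned at the start of the path
    excess-odd-early : ∀ a → a < m →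
                       let z = zigzag (N + N ∸ suc a + m) in m ≤ z + a + 1 × z + a + 1 ≤ suc N
    excess-odd-early a a<m = ≡m⇒bounded (+-cancelʳ-≡ s _ _ (begin
      zigzag u + a + 1 + s             ≡⟨ rearrange (zigzag u) a s ⟩
      zigzag u + (s + suc a)           ≡⟨ cong (zigzag u +_) s+1+a≡2N ⟩
      zigzag u + (N + N)               ≡⟨ cong (_+ (N + N)) (zigzag-high 2N≤u) ⟩
      u ∸ (N + N) + (N + N)            ≡⟨ m∸n+n≡m 2N≤u ⟩
      s + m                            ≡⟨ +-comm s m ⟩
      m + s                            ∎))
      where
      open ≡-Reasoning
      s = N + N ∸ suc a
      u = s + m
      s+1+a≡2N : s + suc a ≡ N + N
      s+1+a≡2N = m∸n+n≡m (≤-trans (m<n⇒m<1+n (m<n⇒m<1+n a<m)) (m≤m+n N N))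
      2N≤u : N + N ≤ u
      2N≤u = subst (_≤ u) s+1+a≡2N (+-monoʳ-≤ s a<m)
      rearrange : ∀ z a s → z + a + 1 + s ≡ z + (s + suc a)
      rearrange = solve-∀

    -- an odd agent a ≥ m is still on its way to the start
    excess-odd-late : ∀ a → a < N → m ≤ a →
                      let z = zigzag (N + N ∸ suc a + m) in m ≤ z + a + 1 × z + a + 1 ≤ suc N
    excess-odd-late a a<N m≤a = ≤-trans m≤a (≤-trans (m≤n+m a (zigzag u)) (m≤m+n _ 1)) , (begin
      zigzag u + a + 1                 ≤⟨ +-monoˡ-≤ 1 (+-mono-≤ z≤1 (≤-pred a<N)) ⟩
      1 + suc m + 1                    ≡⟨ +-comm (suc (suc m)) 1 ⟩
      suc N                            ∎)
      where
      open ≤-Reasoning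
      s = N + N ∸ suc a
      u = s + m
      s+1+a≡2N : s + suc a ≡ N + N
      s+1+a≡2N = m∸n+n≡m (≤-trans a<N (m≤m+n N N))
      N≤u : N ≤ u
      N≤u = ≤-trans (+-cancelʳ-≤ (suc a) N s (subst (N + suc a ≤_) (sym s+1+a≡2N) (+-monoʳ-≤ N a<N)))
                    (m≤m+n s m)
      u<2N : u < N + N
      u<2N = subst (u <_) s+1+a≡2N (+-monoʳ-< s (s≤s m≤a))
      z+m≡a : zigzag u + m ≡ a
      z+m≡a = suc-injective (+-cancelˡ-≡ s _ _ (Eq.begin
        s + suc (zigzag u + m)     Eq.≡⟨ rearrange (zigzag u) s m ⟩
        zigzag u + suc u           Eq.≡⟨ cong (_+ suc u) (zigzag-mid N≤u u<2N) ⟩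
        N + N ∸ suc u + suc u      Eq.≡⟨ m∸n+n≡m u<2N ⟩
        N + N                      Eq.≡⟨ s+1+a≡2N ⟨
        s + suc a                  Eq.∎))
        where
        module Eq = ≡-Reasoning
        rearrange : ∀ z s m → s + suc (z + m) ≡ z + suc (s + m)
        rearrange = solve-∀
      z≤1 : zigzag u ≤ 1
      z≤1 = +-cancelʳ-≤ m (zigzag u) 1 (subst (_≤ suc m) (sym z+m≡a) (≤-pred a<N))

  excess-bounds : ∀ {a} → a < N → m ≤ excess a × excess a ≤ suc N
  excess-bounds {a} a<N with odd a in odd[a]
  excess-bounds {zero}          a<N | false = excess-zero
  excess-bounds {suc (suc a)}   a<N | false = excess-even a a<N
  excess-bounds {a}             a<N | true with <-≤-connex a m
  ... | inj₁ a<m = excess-odd-early a a<m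
  ... | inj₂ m≤a = excess-odd-late a a<N m≤a

  nearly-reversed : ∀ {a b} → suc (suc a) ≤ b → b < N → finalPosition b ≤ suc (finalPosition a)
  nearly-reversed {a} {b} gap b<N = +-cancelʳ-≤ (b + oddBit b) (finalPosition b) (suc (finalPosition a)) (begin
    finalPosition b + (b + oddBit b)           ≡⟨ +-assoc (finalPosition b) b (oddBit b) ⟨
    excess b                                   ≤⟨ proj₂ (excess-bounds b<N) ⟩
    3 + m                                      ≤⟨ +-monoʳ-≤ 3 (proj₁ (excess-bounds a<N)) ⟩
    3 + excess a                               ≡⟨ rearrange (finalPosition a) a (oddBit a) ⟩
    suc (finalPosition a) + (a + oddBit a + 2) ≤⟨ +-monoʳ-≤ (suc (finalPosition a)) (parity-gap gap) ⟩
    suc (finalPosition a) + (b + oddBit b)     ∎)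
    where
    open ≤-Reasoning
    a<N : a < N
    a<N = <-trans (≤-trans (n≤1+n (suc a)) gap) b<N
    rearrange : ∀ f a o → 3 + (f + a + o) ≡ suc f + (a + o + 2)
    rearrange = solve-∀

  pathStrategy : List (Matching (pathGraph N))
  pathStrategy = sweep 0 m

  length-pathStrategy : length pathStrategy ≡ m
  length-pathStrategy = length-sweep 0 m

  toℕ-position-last : ∀ a → toℕ (position pathStrategy m a) ≡ finalPosition (toℕ a)
  toℕ-position-last a =
    trans (cong (λ ms → toℕ (vertexOf ms a)) (take-sweep 0 {m} ≤-refl))
          (toℕ-vertexOf-sweep m a (m<n⇒m<1+n (n<1+n m)))

  ordered-agents-meet : ∀ {a b} → toℕ a < toℕ b →
                        ∃[ t ] (t ≤ m × suc (toℕ (position pathStrategy t a)) ≡ toℕ (position pathStrategy t b))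
  ordered-agents-meet {a} {b} a<b with toℕ b ≟ suc (toℕ a)
  ... | yes b≡1+a = 0 , z≤n , sym b≡1+a
  ... | no b≢1+a with m≤n⇒m<n∨m≡n (nearly-reversed (≤∧≢⇒< a<b (b≢1+a ∘ sym)) (toℕ<n b))
  ...   | inj₂ adjacent = m , ≤-refl ,
          trans (cong suc (toℕ-position-last a)) (trans (sym adjacent) (sym (toℕ-position-last b)))
  ...   | inj₁ not-behind
    with overtaking⇒adjacent pathStrategy m (≤-reflexive (sym length-pathStrategy)) a<b overtaken
    where
    overtaken : toℕ (position pathStrategy m b) < toℕ (position pathStrategy m a)
    overtaken = subst₂ _<_ (sym (toℕ-position-last b)) (sym (toℕ-position-last a)) (≤∧≢⇒< (≤-pred not-behind) distinct)
      where
      distinct : finalPosition (toℕ b) ≢ finalPosition (toℕ a)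
      distinct same = <⇒≢ a<b (cong toℕ (position-injective pathStrategy m
        (toℕ-injective (trans (toℕ-position-last a) (trans (sym same) (sym (toℕ-position-last b)))))))
  ...     | t , t<m , adjacent = t , <⇒≤ t<m , adjacent

  pathStrategy-isStrategy : IsStrategy (pathGraph N) pathStrategy
  pathStrategy-isStrategy = meet⇒strategy meet
    where
    meet : ∀ a b → a ≢ b → Meet pathStrategy a b
    meet a b a≢b with <-cmp (toℕ a) (toℕ b)
    ... | tri< a<b _ _ = let (t , t≤m , adj) = ordered-agents-meet a<b in
                         t , subst (t ≤_) (sym length-pathStrategy) t≤m , inj₁ adj
    ... | tri≈ _ a≡b _ = ⊥-elim (a≢b (toℕ-injective a≡b))
    ... | tri> _ _ b<a = let (t , t≤m , adj) = ordered-agents-meet b<a in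
                         t , subst (t ≤_) (sym length-pathStrategy) t≤m , inj₂ adj

  barbellStrategy : List (Matching (barbellGraph N))
  barbellStrategy = map (widen path⊆barbell) pathStrategy

  length-barbellStrategy : length barbellStrategy ≡ m
  length-barbellStrategy = trans (length-map (widen path⊆barbell) pathStrategy) length-pathStrategy

  barbellStrategy-isStrategy : IsStrategy (barbellGraph N) barbellStrategy
  barbellStrategy-isStrategy = widen-strategy path⊆barbell pathStrategy-isStrategy


theorem3p1 : (n : ℕ) → 2 ≤ n →
    IsAcquaintanceTime (pathGraph n) (n ∸ 2) × IsAcquaintanceTime (barbellGraph n) (n ∸ 2)
theorem3p1 (suc (suc m)) (s≤s (s≤s z≤n)) =
  ((pathStrategy m , length-pathStrategy m , pathStrategy-isStrategy m) , path-lowerBound) ,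
  ((barbellStrategy m , length-barbellStrategy m , barbellStrategy-isStrategy m) , barbell-lowerBound)
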